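{- Let $L$ be a finite lattice with minimum $\hat{0}$ and maximum $\hat{1}$, let $I\subseteq L$ be a proper ideal, and let $\mathcal{G}=\{[\hat{0},y]\mid y\in \overline{L}\setminus I\}\cup\{[x,\hat{1}]\mid x\in I\setminus \{\hat{0}\}\}$, a building set of the lattice $\mathrm{Bier}(L,I)_{<\hat{1}}$. Then a (possibly empty) subset $A\subseteq\mathcal{G}$ is nested if and only if: (i) whenever $[\hat{0},y_1],[\hat{0},y_2]\in A$, the elements $y_1,y_2$ are comparable in $L$; (ii) whenever $[x_1,\hat{1}],[x_2,\hat{1}]\in A$, the elements $x_1,x_2$ are comparable in $L$; (iii) whenever $[x,\hat{1}],[\hat{0},y]\in A$, we have $x<y$ in $L$.
   Context: An ideal $I$ of $L$ is a down-closed subset; proper means $I\ne\emptyset,L$. $\overline{L}=L\setminus\{\hat 0,\hat 1\}$. $\mathrm{Bier}(L,I)$ is the poset of all intervals $[x,y]\subseteq L$ with $x\in I$, $y\notin I$, plus an extra top element $\hat 1$, ordered by reverse inclusion ($[x,y]\le[v,w]$ iff $x\le v<w\le y$); $\mathrm{Bier}(L,I)_{<\hat 1}$ is it with the extra top removed (a semilattice with minimum $[\hat0,\hat1]$). For a semilattice $\mathcal{L}$ with building set $\mathcal{G}$, a subset $N\subseteq\mathcal{G}$ is nested if for every subset $\{x_1,\dots,x_t\}\subseteq N$ with $t\ge 2$ of pairwise incomparable elements, the join $x_1\vee\dots\vee x_t$ exists in $\mathcal{L}$ and does not belong to $\mathcal{G}$. -}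

module Defs where

open import Level using (0ℓ)
open import Data.Nat using (ℕ; _≥_)
open import Data.Fin using (Fin)
open import Data.Product using (Σ; ∃; _×_; _,_; proj₁; proj₂)
open import Data.Sum using (_⊎_)
open import Data.List using (List; length)
open import Data.List.Relation.Unary.All using (All)
open import Data.List.Relation.Unary.AllPairs using (AllPairs)
open import Relation.Nullary using (¬_)
open import Relation.Unary using (Pred; _⊆_)
open import Relation.Binary.Core using (Rel)
open import Relation.Binary.PropositionalEquality using (_≡_; _≢_)
open import Relation.Binary.Lattice.Structures using (IsBoundedLattice)

-- A finite lattice, presented (up to isomorphism) on the carrier Fin n,
-- with propositional equality, partial order _≤_, join _∨_, meet _∧_,
-- maximum 1̂ and minimum 0̂.
record FiniteLattice : Set₁ where
  field
    n   : ℕ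
    _≤_ : Rel (Fin n) 0ℓ
    _∨_ : Fin n → Fin n → Fin n
    _∧_ : Fin n → Fin n → Fin n
    1̂   : Fin n
    0̂   : Fin n
    isBoundedLattice : IsBoundedLattice _≡_ _≤_ _∨_ _∧_ 1̂ 0̂

  Carrier : Set
  Carrier = Fin n

  _<_ : Rel Carrier 0ℓ
  x < y = x ≤ y × x ≢ y

module _ (L : FiniteLattice) where
  open FiniteLattice L

  IsIdeal : Pred Carrier 0ℓ → Set
  IsIdeal I = ∀ x y → y ≤ x → I x → I y

  IsProper : Pred Carrier 0ℓ → Set
  IsProper I = (∃ λ x → I x) × (∃ λ x → ¬ I x)

  Interval : Set
  Interval = Carrier × Carrier

  InBier : Pred Carrier 0ℓ → Pred Interval 0ℓ
  InBier I (x , y) = x ≤ y × I x × ¬ I y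

  -- reverse inclusion order: [x,y] ⊑ [v,w] iff x ≤ v < w ≤ y
  _⊑_ : Rel Interval 0ℓ
  (x , y) ⊑ (v , w) = x ≤ v × v < w × w ≤ y

  Incomparable : Rel Interval 0ℓ
  Incomparable a b = ¬ (a ⊑ b) × ¬ (b ⊑ a)

  IsJoinIn : Pred Carrier 0ℓ → List Interval → Interval → Set
  IsJoinIn I xs j =
    InBier I j × All (_⊑ j) xs ×
    (∀ u → InBier I u → All (_⊑ u) xs → j ⊑ u)

  BuildingSet : Pred Carrier 0ℓ → Pred Interval 0ℓ
  BuildingSet I (x , y) =
    (x ≡ 0̂ × (y ≢ 0̂ × y ≢ 1̂) × ¬ I y) ⊎ (y ≡ 1̂ × I x × x ≢ 0̂)

  -- N ⊆ G is nested if for every set {x₁,…,xₜ} ⊆ N, t ≥ 2, of pairwise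
  -- incomparable elements, the join exists in Bier(L,I)_{<1̂} and is not in G.
  -- (Pairwise incomparability forces the listed elements to be distinct.)
  IsNested : Pred Carrier 0ℓ → Pred Interval 0ℓ → Set
  IsNested I N =
    ∀ (xs : List Interval) → All N xs → length xs ≥ 2 →
    AllPairs Incomparable xs →
    Σ Interval λ j → IsJoinIn I xs j × ¬ BuildingSet I j

-- Two building-set elements of the same shape, [0̂,y₁] and [0̂,y₂] (or [x₁,1̂] and [x₂,1̂]),
-- are incomparable exactly when y₁,y₂ (or x₁,x₂) are, and then their join is again of the
-- form [0̂,q] (or [p,1̂]) and lies in the building set; so nestedness forces (i) and (ii).
-- A mixed pair [x,1̂], [0̂,y] is always incomparable, and it has a join iff x < y, namely
-- [x,y], which is not in the building set. Under (i)–(iii) only mixed pairs are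
-- incomparable, so no three elements are pairwise incomparable.
module Submission where

open import Defs
open import Data.Product using (Σ; _×_; _,_; proj₁; proj₂)
open import Data.Sum using (_⊎_; inj₁; inj₂)
open import Data.Empty using (⊥; ⊥-elim)
open import Data.Nat using (s≤s; z≤n)
open import Data.Fin using () renaming (_≟_ to _≟ᶠ_)
open import Data.List using ([]; _∷_)
open import Data.List.Relation.Unary.All using ([]; _∷_)
open import Data.List.Relation.Unary.AllPairs using ([]; _∷_)
open import Relation.Nullary using (¬_; yes; no)
open import Relation.Unary using (Pred; _⊆_)
open import Relation.Binary.Definitions using (Decidable)
open import Relation.Binary.PropositionalEquality using (_≡_; _≢_; refl; sym; subst)
open import Relation.Binary.Lattice.Bundles using (JoinSemilattice)
open import Relation.Binary.Lattice.Structures using (IsBoundedLattice)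
import Relation.Binary.Lattice.Properties.JoinSemilattice as JoinSemilatticeProperties
open import Level using (0ℓ)
open import Function using (_⇔_; mk⇔)

module _ (L : FiniteLattice) where
  open FiniteLattice L
  open IsBoundedLattice isBoundedLattice
    using (maximum; minimum; antisym; isJoinSemilattice)
    renaming (refl to ≤-refl; trans to ≤-trans)

  joinSemilattice : JoinSemilattice 0ℓ 0ℓ 0ℓ
  joinSemilattice = record { isJoinSemilattice = isJoinSemilattice }

  _≤?_ : Decidable _≤_
  _≤?_ = JoinSemilatticeProperties.≈-dec⇒≤-dec joinSemilattice _≟ᶠ_

  ≤0̂⇒≡0̂ : ∀ {x} → x ≤ 0̂ → x ≡ 0̂
  ≤0̂⇒≡0̂ {x} x≤0̂ = antisym x≤0̂ (minimum x)

  1̂≤⇒≡1̂ : ∀ {y} → 1̂ ≤ y → y ≡ 1̂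
  1̂≤⇒≡1̂ {y} 1̂≤y = antisym (maximum y) 1̂≤y

  lower-⊑ : ∀ {y₁ y₂} → 0̂ < y₁ → y₁ ≤ y₂ → _⊑_ L (0̂ , y₂) (0̂ , y₁)
  lower-⊑ 0̂<y₁ y₁≤y₂ = ≤-refl , 0̂<y₁ , y₁≤y₂

  upper-⊑ : ∀ {x₁ x₂} → x₁ ≤ x₂ → x₂ < 1̂ → _⊑_ L (x₁ , 1̂) (x₂ , 1̂)
  upper-⊑ x₁≤x₂ x₂<1̂ = x₁≤x₂ , x₂<1̂ , ≤-refl

  comparable⇒¬lowers-incomparable : ∀ {y₁ y₂} → y₁ ≤ y₂ ⊎ y₂ ≤ y₁ → 0̂ < y₁ → 0̂ < y₂ →
    ¬ Incomparable L (0̂ , y₁) (0̂ , y₂)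
  comparable⇒¬lowers-incomparable (inj₁ y₁≤y₂) 0̂<y₁ _ (_ , ⋢) = ⋢ (lower-⊑ 0̂<y₁ y₁≤y₂)
  comparable⇒¬lowers-incomparable (inj₂ y₂≤y₁) _ 0̂<y₂ (⋢ , _) = ⋢ (lower-⊑ 0̂<y₂ y₂≤y₁)

  comparable⇒¬uppers-incomparable : ∀ {x₁ x₂} → x₁ ≤ x₂ ⊎ x₂ ≤ x₁ → x₁ < 1̂ → x₂ < 1̂ →
    ¬ Incomparable L (x₁ , 1̂) (x₂ , 1̂)
  comparable⇒¬uppers-incomparable (inj₁ x₁≤x₂) _ x₂<1̂ (⋢ , _) = ⋢ (upper-⊑ x₁≤x₂ x₂<1̂)
  comparable⇒¬uppers-incomparable (inj₂ x₂≤x₁) x₁<1̂ _ (_ , ⋢) = ⋢ (upper-⊑ x₂≤x₁ x₁<1̂)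

  ¬comparable⇒lowers-incomparable : ∀ {y₁ y₂} → ¬ y₁ ≤ y₂ → ¬ y₂ ≤ y₁ →
    Incomparable L (0̂ , y₁) (0̂ , y₂)
  ¬comparable⇒lowers-incomparable y₁≰y₂ y₂≰y₁ =
    (λ (_ , _ , y₂≤y₁) → y₂≰y₁ y₂≤y₁) , (λ (_ , _ , y₁≤y₂) → y₁≰y₂ y₁≤y₂)

  ¬comparable⇒uppers-incomparable : ∀ {x₁ x₂} → ¬ x₁ ≤ x₂ → ¬ x₂ ≤ x₁ →
    Incomparable L (x₁ , 1̂) (x₂ , 1̂)
  ¬comparable⇒uppers-incomparable x₁≰x₂ x₂≰x₁ =
    (λ (x₁≤x₂ , _) → x₁≰x₂ x₁≤x₂) , (λ (x₂≤x₁ , _) → x₂≰x₁ x₂≤x₁)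

  upper-lower-incomparable : ∀ {x y} → x ≢ 0̂ → y ≢ 1̂ → Incomparable L (x , 1̂) (0̂ , y)
  upper-lower-incomparable x≢0̂ y≢1̂ =
    (λ (x≤0̂ , _) → x≢0̂ (≤0̂⇒≡0̂ x≤0̂)) , (λ (_ , _ , 1̂≤y) → y≢1̂ (1̂≤⇒≡1̂ 1̂≤y))

  module _ {I : Pred Carrier 0ℓ} (ideal : IsIdeal L I) (proper : IsProper L I) where

    0̂∈I : I 0̂
    0̂∈I = let (x , x∈I) = proj₁ proper in ideal x 0̂ (minimum x) x∈I

    1̂∉I : ¬ I 1̂
    1̂∉I 1̂∈I = let (y , y∉I) = proj₂ proper in y∉I (ideal 1̂ y (maximum y) 1̂∈I)

    ∈∉⇒≢ : ∀ {x y} → I x → ¬ I y → x ≢ y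
    ∈∉⇒≢ x∈I y∉I refl = y∉I x∈I

    ∉⇒0̂< : ∀ {y} → ¬ I y → 0̂ < y
    ∉⇒0̂< {y} y∉I = minimum y , ∈∉⇒≢ 0̂∈I y∉I

    ∈⇒<1̂ : ∀ {x} → I x → x < 1̂
    ∈⇒<1̂ {x} x∈I = maximum x , ∈∉⇒≢ x∈I 1̂∉I

    lower-∈G : ∀ {y} → BuildingSet L I (0̂ , y) → (y ≢ 0̂ × y ≢ 1̂) × ¬ I y
    lower-∈G (inj₁ (_ , y≢0̂,1̂ , y∉I)) = y≢0̂,1̂ , y∉I
    lower-∈G (inj₂ (_ , _ , 0̂≢0̂)) = ⊥-elim (0̂≢0̂ refl)

    upper-∈G : ∀ {x} → BuildingSet L I (x , 1̂) → I x × x ≢ 0̂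
    upper-∈G (inj₁ (_ , (_ , 1̂≢1̂) , _)) = ⊥-elim (1̂≢1̂ refl)
    upper-∈G (inj₂ (_ , x∈I , x≢0̂)) = x∈I , x≢0̂

    data Shape : Interval L → Set where
      lower : ∀ y → Shape (0̂ , y)
      upper : ∀ x → Shape (x , 1̂)

    shape : ∀ {a} → BuildingSet L I a → Shape a
    shape {_ , y} (inj₁ (refl , _)) = lower y
    shape {x , _} (inj₂ (refl , _)) = upper x

    mixed-∉G : ∀ {x y} → x ≢ 0̂ → y ≢ 1̂ → ¬ BuildingSet L I (x , y)
    mixed-∉G x≢0̂ _ (inj₁ (x≡0̂ , _)) = x≢0̂ x≡0̂
    mixed-∉G _ y≢1̂ (inj₂ (y≡1̂ , _)) = y≢1̂ y≡1̂

    IsJoinIn-swap : ∀ {a b j} → IsJoinIn L I (a ∷ b ∷ []) j → IsJoinIn L I (b ∷ a ∷ []) j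
    IsJoinIn-swap (j∈Bier , a⊑j ∷ b⊑j ∷ [] , least) =
      j∈Bier , b⊑j ∷ a⊑j ∷ [] , λ { u u∈Bier (b⊑u ∷ a⊑u ∷ []) → least u u∈Bier (a⊑u ∷ b⊑u ∷ []) }

    upper-lower-join : ∀ {x y} → x < y → I x → ¬ I y →
      IsJoinIn L I ((x , 1̂) ∷ (0̂ , y) ∷ []) (x , y)
    upper-lower-join {x} {y} x<y x∈I y∉I =
      (proj₁ x<y , x∈I , y∉I) ,
      (≤-refl , x<y , maximum y) ∷ (minimum x , x<y , ≤-refl) ∷ [] ,
      λ { _ _ ((x≤v , v<w , _) ∷ (_ , _ , w≤y) ∷ []) → x≤v , v<w , w≤y }

    upper-lower-join⇒≤ : ∀ {x y j} → IsJoinIn L I ((x , 1̂) ∷ (0̂ , y) ∷ []) j → x ≤ y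
    upper-lower-join⇒≤ (_ , (x≤p , (p≤q , _) , _) ∷ (_ , _ , q≤y) ∷ [] , _) =
      ≤-trans x≤p (≤-trans p≤q q≤y)

    -- The join [p,q] is below the upper bound [0̂,q], which forces p = 0̂.
    lowers-join-∈G : ∀ {y₁ y₂ j} → y₁ ≢ 1̂ →
      IsJoinIn L I ((0̂ , y₁) ∷ (0̂ , y₂) ∷ []) j → BuildingSet L I j
    lowers-join-∈G {y₁} {j = p , q} y₁≢1̂ ((_ , _ , q∉I) , (_ , _ , q≤y₁) ∷ (_ , _ , q≤y₂) ∷ [] , least) =
      inj₁ (≤0̂⇒≡0̂ p≤0̂ , (q≢0̂ , q≢1̂) , q∉I)
      where
      0̂<q = ∉⇒0̂< q∉I
      p≤0̂ = proj₁ (least (0̂ , q) (proj₁ 0̂<q , 0̂∈I , q∉I)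
                    ((≤-refl , 0̂<q , q≤y₁) ∷ (≤-refl , 0̂<q , q≤y₂) ∷ []))
      q≢0̂ : q ≢ 0̂
      q≢0̂ q≡0̂ = proj₂ 0̂<q (sym q≡0̂)
      q≢1̂ : q ≢ 1̂
      q≢1̂ q≡1̂ = y₁≢1̂ (1̂≤⇒≡1̂ (subst (_≤ y₁) q≡1̂ q≤y₁))

    -- Dually, the join [p,q] is below the upper bound [p,1̂], which forces q = 1̂.
    uppers-join-∈G : ∀ {x₁ x₂ j} → x₁ ≢ 0̂ →
      IsJoinIn L I ((x₁ , 1̂) ∷ (x₂ , 1̂) ∷ []) j → BuildingSet L I j
    uppers-join-∈G {x₁} {j = p , q} x₁≢0̂ ((_ , p∈I , _) , (x₁≤p , _) ∷ (x₂≤p , _) ∷ [] , least) =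
      inj₂ (1̂≤⇒≡1̂ 1̂≤q , p∈I , p≢0̂)
      where
      p<1̂ = ∈⇒<1̂ p∈I
      1̂≤q = proj₂ (proj₂ (least (p , 1̂) (proj₁ p<1̂ , p∈I , 1̂∉I)
                           ((x₁≤p , p<1̂ , ≤-refl) ∷ (x₂≤p , p<1̂ , ≤-refl) ∷ [])))
      p≢0̂ : p ≢ 0̂
      p≢0̂ p≡0̂ = x₁≢0̂ (≤0̂⇒≡0̂ (subst (x₁ ≤_) p≡0̂ x₁≤p))

    module _ (A : Pred (Interval L) 0ℓ) (A⊆G : A ⊆ BuildingSet L I) where

      LowersComparable UppersComparable UppersBelowLowers : Set
      LowersComparable = ∀ y₁ y₂ → A (0̂ , y₁) → A (0̂ , y₂) → y₁ ≤ y₂ ⊎ y₂ ≤ y₁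
      UppersComparable = ∀ x₁ x₂ → A (x₁ , 1̂) → A (x₂ , 1̂) → x₁ ≤ x₂ ⊎ x₂ ≤ x₁
      UppersBelowLowers = ∀ x y → A (x , 1̂) → A (0̂ , y) → x < y

      nested⇒pair-join : IsNested L I A → ∀ {a b} → A a → A b → Incomparable L a b →
        Σ (Interval L) λ j → IsJoinIn L I (a ∷ b ∷ []) j × ¬ BuildingSet L I j
      nested⇒pair-join nested a∈A b∈A a∥b =
        nested _ (a∈A ∷ b∈A ∷ []) (s≤s (s≤s z≤n)) ((a∥b ∷ []) ∷ [] ∷ [])

      nested⇒lowers-comparable : IsNested L I A → LowersComparable
      nested⇒lowers-comparable nested y₁ y₂ a₁ a₂ with y₁ ≤? y₂ | y₂ ≤? y₁
      ... | yes y₁≤y₂ | _         = inj₁ y₁≤y₂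
      ... | no _      | yes y₂≤y₁ = inj₂ y₂≤y₁
      ... | no y₁≰y₂  | no y₂≰y₁  =
        let (_ , join , j∉G) = nested⇒pair-join nested a₁ a₂
                                 (¬comparable⇒lowers-incomparable y₁≰y₂ y₂≰y₁)
        in ⊥-elim (j∉G (lowers-join-∈G (proj₂ (proj₁ (lower-∈G (A⊆G a₁)))) join))

      nested⇒uppers-comparable : IsNested L I A → UppersComparable
      nested⇒uppers-comparable nested x₁ x₂ a₁ a₂ with x₁ ≤? x₂ | x₂ ≤? x₁
      ... | yes x₁≤x₂ | _         = inj₁ x₁≤x₂
      ... | no _      | yes x₂≤x₁ = inj₂ x₂≤x₁
      ... | no x₁≰x₂  | no x₂≰x₁  =
        let (_ , join , j∉G) = nested⇒pair-join nested a₁ a₂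
                                 (¬comparable⇒uppers-incomparable x₁≰x₂ x₂≰x₁)
        in ⊥-elim (j∉G (uppers-join-∈G (proj₂ (upper-∈G (A⊆G a₁))) join))

      nested⇒uppers-below-lowers : IsNested L I A → UppersBelowLowers
      nested⇒uppers-below-lowers nested x y a₁ a₂ =
        let (x∈I , x≢0̂) = upper-∈G (A⊆G a₁)
            ((_ , y≢1̂) , y∉I) = lower-∈G (A⊆G a₂)
            (_ , join , _) = nested⇒pair-join nested a₁ a₂ (upper-lower-incomparable x≢0̂ y≢1̂)
        in upper-lower-join⇒≤ join , ∈∉⇒≢ x∈I y∉I

      module _ (lowers : LowersComparable) (uppers : UppersComparable)
               (below : UppersBelowLowers) where

        ¬lowers-incomparable : ∀ {y₁ y₂} → A (0̂ , y₁) → A (0̂ , y₂) →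
          ¬ Incomparable L (0̂ , y₁) (0̂ , y₂)
        ¬lowers-incomparable a₁ a₂ = comparable⇒¬lowers-incomparable (lowers _ _ a₁ a₂)
          (∉⇒0̂< (proj₂ (lower-∈G (A⊆G a₁)))) (∉⇒0̂< (proj₂ (lower-∈G (A⊆G a₂))))

        ¬uppers-incomparable : ∀ {x₁ x₂} → A (x₁ , 1̂) → A (x₂ , 1̂) →
          ¬ Incomparable L (x₁ , 1̂) (x₂ , 1̂)
        ¬uppers-incomparable a₁ a₂ = comparable⇒¬uppers-incomparable (uppers _ _ a₁ a₂)
          (∈⇒<1̂ (proj₁ (upper-∈G (A⊆G a₁)))) (∈⇒<1̂ (proj₁ (upper-∈G (A⊆G a₂))))

        ¬incomparable-triple : ∀ {a b c} → A a → A b → A c →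
          Incomparable L a b → Incomparable L a c → Incomparable L b c → ⊥
        ¬incomparable-triple a∈A b∈A c∈A a∥b a∥c b∥c
          with shape (A⊆G a∈A) | shape (A⊆G b∈A) | shape (A⊆G c∈A)
        ... | lower _ | lower _ | _       = ¬lowers-incomparable a∈A b∈A a∥b
        ... | upper _ | upper _ | _       = ¬uppers-incomparable a∈A b∈A a∥b
        ... | lower _ | upper _ | lower _ = ¬lowers-incomparable a∈A c∈A a∥c
        ... | lower _ | upper _ | upper _ = ¬uppers-incomparable b∈A c∈A b∥c
        ... | upper _ | lower _ | lower _ = ¬lowers-incomparable b∈A c∈A b∥c
        ... | upper _ | lower _ | upper _ = ¬uppers-incomparable a∈A c∈A a∥c

        upper-lower-join∉G : ∀ {x y} → A (x , 1̂) → A (0̂ , y) →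
          IsJoinIn L I ((x , 1̂) ∷ (0̂ , y) ∷ []) (x , y) × ¬ BuildingSet L I (x , y)
        upper-lower-join∉G a₁ a₂ =
          let (x∈I , x≢0̂) = upper-∈G (A⊆G a₁)
              ((_ , y≢1̂) , y∉I) = lower-∈G (A⊆G a₂)
          in upper-lower-join (below _ _ a₁ a₂) x∈I y∉I , mixed-∉G x≢0̂ y≢1̂

        incomparable-pair-join : ∀ {a b} → A a → A b → Incomparable L a b →
          Σ (Interval L) λ j → IsJoinIn L I (a ∷ b ∷ []) j × ¬ BuildingSet L I j
        incomparable-pair-join a∈A b∈A a∥b with shape (A⊆G a∈A) | shape (A⊆G b∈A)
        ... | lower _ | lower _ = ⊥-elim (¬lowers-incomparable a∈A b∈A a∥b)
        ... | upper _ | upper _ = ⊥-elim (¬uppers-incomparable a∈A b∈A a∥b)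
        ... | upper _ | lower _ = let (join , j∉G) = upper-lower-join∉G a∈A b∈A in _ , join , j∉G
        ... | lower _ | upper _ =
          let (join , j∉G) = upper-lower-join∉G b∈A a∈A in _ , IsJoinIn-swap join , j∉G

        conditions⇒nested : IsNested L I A
        conditions⇒nested (_ ∷ _ ∷ _ ∷ _) (a∈A ∷ b∈A ∷ c∈A ∷ _) _ ((a∥b ∷ a∥c ∷ _) ∷ (b∥c ∷ _) ∷ _) =
          ⊥-elim (¬incomparable-triple a∈A b∈A c∈A a∥b a∥c b∥c)
        conditions⇒nested (_ ∷ _ ∷ []) (a∈A ∷ b∈A ∷ []) _ ((a∥b ∷ []) ∷ _) =
          incomparable-pair-join a∈A b∈A a∥b
        conditions⇒nested (_ ∷ []) _ (s≤s ()) _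
        conditions⇒nested [] _ () _

lemma2p2 : (L : FiniteLattice) → (I : Pred (FiniteLattice.Carrier L) 0ℓ) →
    IsIdeal L I → IsProper L I →
    (A : Pred (Interval L) 0ℓ) → A ⊆ BuildingSet L I →
    (IsNested L I A ⇔
      ((∀ y₁ y₂ → A (FiniteLattice.0̂ L , y₁) → A (FiniteLattice.0̂ L , y₂) →
          FiniteLattice._≤_ L y₁ y₂ ⊎ FiniteLattice._≤_ L y₂ y₁) ×
       (∀ x₁ x₂ → A (x₁ , FiniteLattice.1̂ L) → A (x₂ , FiniteLattice.1̂ L) →
          FiniteLattice._≤_ L x₁ x₂ ⊎ FiniteLattice._≤_ L x₂ x₁) ×
       (∀ x y → A (x , FiniteLattice.1̂ L) → A (FiniteLattice.0̂ L , y) →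
          FiniteLattice._<_ L x y)))
lemma2p2 L I ideal proper A A⊆G = mk⇔
  (λ nested → nested⇒lowers-comparable L ideal proper A A⊆G nested ,
              nested⇒uppers-comparable L ideal proper A A⊆G nested ,
              nested⇒uppers-below-lowers L ideal proper A A⊆G nested)
  (λ (lowers , uppers , below) → conditions⇒nested L ideal proper A A⊆G lowers uppers below)
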